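{- Let $K$ be an infinite field and $n\le r$ integers with $r\le 4n/3$. One can choose $R\in GL_r(K)$ and three diagonal matrices $D_1,D_2,D_3\in M_r(K)$ such that, with $Z_i=R^{ -1}D_iR$ and $A_i$ the top-left $n\times n$ block of $Z_i$ ($i=1,2,3$), one has $\dim(\operatorname{Im}[A_1,A_2]+\operatorname{Im}[A_1,A_3])=3(r-n)$.
   Context: $[A,B]=AB-BA$, $\operatorname{Im}A$ denotes the column space. -}

module Defs where

open import Level using (_⊔_)
open import Data.Nat using (ℕ; zero; suc; _≤_)
open import Data.Fin using (Fin; inject≤)
import Data.Fin as F
open import Data.Product using (Σ; ∃; _×_)
open import Relation.Nullary using (¬_)
open import Relation.Binary.PropositionalEquality using (_≡_)
open import Algebra.Bundles using (CommutativeRing)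

module LinAlg {c ℓ} (K : CommutativeRing c ℓ) where
  open CommutativeRing K

  IsField : Set (c ⊔ ℓ)
  IsField = (¬ (1# ≈ 0#)) × (∀ x → ¬ (x ≈ 0#) → ∃ λ y → x * y ≈ 1#)

  Infinite : Set (c ⊔ ℓ)
  Infinite = ∃ λ (f : ℕ → Carrier) → ∀ m k → f m ≈ f k → m ≡ k

  Vec : ℕ → Set c
  Vec n = Fin n → Carrier

  Mat : ℕ → ℕ → Set c
  Mat m k = Fin m → Fin k → Carrier

  sumF : ∀ n → (Fin n → Carrier) → Carrier
  sumF zero    f = 0#
  sumF (suc n) f = f F.zero + sumF n (λ i → f (F.suc i))

  _⊗_ : ∀ {m k p} → Mat m k → Mat k p → Mat m p
  _⊗_ {k = k} A B i j = sumF k (λ l → A i l * B l j)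

  _⊖_ : ∀ {m k} → Mat m k → Mat m k → Mat m k
  (A ⊖ B) i j = A i j - B i j

  _·_ : ∀ {m k} → Mat m k → Vec k → Vec m
  _·_ {k = k} A x i = sumF k (λ l → A i l * x l)

  _≈ᵥ_ : ∀ {n} → Vec n → Vec n → Set ℓ
  u ≈ᵥ v = ∀ i → u i ≈ v i

  _≈ₘ_ : ∀ {m k} → Mat m k → Mat m k → Set ℓ
  A ≈ₘ B = ∀ i j → A i j ≈ B i j

  identity : ∀ {n} → Mat n n
  identity i j with i F.≟ j
  ... | Relation.Nullary.yes _ = 1#
  ... | Relation.Nullary.no _  = 0#

  diag : ∀ {n} → Vec n → Mat n n
  diag d i j with i F.≟ j
  ... | Relation.Nullary.yes _ = d i
  ... | Relation.Nullary.no _  = 0#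

  IsInverse : ∀ {n} → Mat n n → Mat n n → Set ℓ
  IsInverse R S = ((R ⊗ S) ≈ₘ identity) × ((S ⊗ R) ≈ₘ identity)

  ⟦_,_⟧ : ∀ {n} → Mat n n → Mat n n → Mat n n
  ⟦ A , B ⟧ = (A ⊗ B) ⊖ (B ⊗ A)

  topLeft : ∀ {n r} → n ≤ r → Mat r r → Mat n n
  topLeft n≤r Z i j = Z (inject≤ i n≤r) (inject≤ j n≤r)

  ImSum : ∀ {n k p} → Mat n k → Mat n p → Vec n → Set (c ⊔ ℓ)
  ImSum A B v = ∃ λ x → ∃ λ y → v ≈ᵥ (λ i → (A · x) i + (B · y) i)

  lincomb : ∀ {n d} → (Fin d → Vec n) → Vec d → Vec n
  lincomb {d = d} b coef i = sumF d (λ k → coef k * b k i)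

  LinIndep : ∀ {n d} → (Fin d → Vec n) → Set (c ⊔ ℓ)
  LinIndep {n} b = ∀ coef → lincomb b coef ≈ᵥ (λ _ → 0#) → ∀ k → coef k ≈ 0#

  HasDim : ∀ {n a} → (Vec n → Set a) → ℕ → Set (c ⊔ ℓ ⊔ a)
  HasDim {n} W d = ∃ λ (b : Fin d → Vec n) →
    (∀ k → W (b k)) × LinIndep b × (∀ w → W w → ∃ λ coef → w ≈ᵥ lincomb b coef)

module Submission where

-- Write r = n + k and choose 3k of the first n coordinates of K^r, grouped as slots s(a, J) with a < 3,
-- J < k. Let X be the n × k matrix whose column J is e_s(0,J) + e_s(1,J) + e_s(2,J), put
-- R = [[I, X], [0, I]] [[I, 0], [-Xᵀ, I]], and let D_a be the diagonal projection onto the slots of group a.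
-- The top rows of R⁻¹ are (I, -X) and D_a vanishes on the last k coordinates, so the top-left block of
-- R⁻¹ D_a R is A_a = D_a (I - X Xᵀ). Hence A_a e_s(i,J) is 0 for a = i and -e_s(a,J) otherwise, which gives
-- [A_a, A_b] e_s(a,J) = e_s(a,J) for a ≠ b, while every row of [A_a, A_b] off the slots vanishes. Therefore
-- Im [A_1, A_2] + Im [A_1, A_3] is the span of the 3k slot coordinate vectors.

open import Algebra.Bundles using (CommutativeRing)
open import Data.Nat.Base as ℕ using (ℕ; zero; suc; _≤_)
import Data.Nat.Properties as ℕP
open import Data.Fin.Base as Fin using (Fin; splitAt)
open import Data.Fin.Patterns using (0F; 1F; 2F)
open import Data.Sum.Base using (_⊎_; inj₁; inj₂; [_,_]; map₁)
open import Data.Product.Base using (∃; _×_; _,_; proj₁; proj₂; swap; uncurry)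
open import Data.Empty using (⊥-elim)
open import Data.Vec.Functional using (_++_)
open import Function.Base using (_∘_)
open import Relation.Nullary using (yes; no)
open import Relation.Binary.PropositionalEquality as ≡ using (_≡_; _≢_)
import Data.Fin.Properties as FinP
import Algebra.Properties.CommutativeSemigroup as CommutativeSemigroupProperties
import Algebra.Properties.Ring as RingProperties
import Algebra.Properties.Semiring.Sum as SemiringSum
import Relation.Binary.Reasoning.Setoid as SetoidReasoning

open import Defs

module MatrixAlgebra {c ℓ} (K : CommutativeRing c ℓ) where
  open CommutativeRing K
  open LinAlg K
  open RingProperties ring
    using (-0#≈0#; -‿involutive; -‿anti-homo-+; -‿distribˡ-*; -‿distribʳ-*; -1*x≈-x)
  open SemiringSum semiring
    using (sum; sum-cong-≋; sum-cong-≗; sum-replicate-zero; ∑-distrib-+; ∑-comm; *-distribˡ-sum; *-distribʳ-sum)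
  open CommutativeSemigroupProperties +-commutativeSemigroup using (interchange)
  open SetoidReasoning setoid

  sumF≡sum : ∀ n (f : Fin n → Carrier) → sumF n f ≡ sum f
  sumF≡sum zero    f = ≡.refl
  sumF≡sum (suc n) f = ≡.cong (f Fin.zero +_) (sumF≡sum n (f ∘ Fin.suc))

  sumF-cong : ∀ n {f g : Fin n → Carrier} → (∀ i → f i ≈ g i) → sumF n f ≈ sumF n g
  sumF-cong n {f} {g} f≈g = begin
    sumF n f ≡⟨ sumF≡sum n f ⟩
    sum f    ≈⟨ sum-cong-≋ f≈g ⟩
    sum g    ≡⟨ sumF≡sum n g ⟨
    sumF n g ∎

  sumF-zero : ∀ n {f : Fin n → Carrier} → (∀ i → f i ≈ 0#) → sumF n f ≈ 0#
  sumF-zero n {f} f≈0 = begin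
    sumF n f           ≡⟨ sumF≡sum n f ⟩
    sum f              ≈⟨ sum-cong-≋ f≈0 ⟩
    sum {n} (λ _ → 0#) ≈⟨ sum-replicate-zero n ⟩
    0#                 ∎

  sumF-+ : ∀ n (f g : Fin n → Carrier) → sumF n (λ i → f i + g i) ≈ sumF n f + sumF n g
  sumF-+ n f g = begin
    sumF n (λ i → f i + g i) ≡⟨ sumF≡sum n _ ⟩
    sum (λ i → f i + g i)    ≈⟨ ∑-distrib-+ f g ⟩
    sum f + sum g            ≡⟨ ≡.cong₂ _+_ (sumF≡sum n f) (sumF≡sum n g) ⟨
    sumF n f + sumF n g      ∎

  *-distribˡ-sumF : ∀ n x (f : Fin n → Carrier) → x * sumF n f ≈ sumF n (λ i → x * f i)
  *-distribˡ-sumF n x f = begin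
    x * sumF n f             ≡⟨ ≡.cong (x *_) (sumF≡sum n f) ⟩
    x * sum f                ≈⟨ *-distribˡ-sum x f ⟩
    sum (λ i → x * f i)      ≡⟨ sumF≡sum n _ ⟨
    sumF n (λ i → x * f i)   ∎

  *-distribʳ-sumF : ∀ n x (f : Fin n → Carrier) → sumF n f * x ≈ sumF n (λ i → f i * x)
  *-distribʳ-sumF n x f = begin
    sumF n f * x             ≡⟨ ≡.cong (_* x) (sumF≡sum n f) ⟩
    sum f * x                ≈⟨ *-distribʳ-sum x f ⟩
    sum (λ i → f i * x)      ≡⟨ sumF≡sum n _ ⟨
    sumF n (λ i → f i * x)   ∎

  sumF-comm : ∀ m n (f : Fin m → Fin n → Carrier) →
              sumF m (λ i → sumF n (f i)) ≈ sumF n (λ j → sumF m (λ i → f i j))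
  sumF-comm m n f = begin
    sumF m (λ i → sumF n (f i))             ≡⟨ sumF≡sum m _ ⟩
    sum (λ i → sumF n (f i))                ≡⟨ sum-cong-≗ (λ i → sumF≡sum n (f i)) ⟩
    sum (λ i → sum (f i))                   ≈⟨ ∑-comm f ⟩
    sum (λ j → sum (λ i → f i j))           ≡⟨ sum-cong-≗ (λ j → sumF≡sum m (λ i → f i j)) ⟨
    sum (λ j → sumF m (λ i → f i j))        ≡⟨ sumF≡sum n _ ⟨
    sumF n (λ j → sumF m (λ i → f i j))     ∎

  sumF-neg : ∀ n (f : Fin n → Carrier) → sumF n (λ i → - f i) ≈ - sumF n f
  sumF-neg n f = begin
    sumF n (λ i → - f i)       ≈⟨ sumF-cong n (λ i → sym (-1*x≈-x (f i))) ⟩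
    sumF n (λ i → - 1# * f i)  ≈⟨ *-distribˡ-sumF n (- 1#) f ⟨
    - 1# * sumF n f            ≈⟨ -1*x≈-x _ ⟩
    - sumF n f                 ∎

  sumF-single : ∀ n {f : Fin n → Carrier} i → (∀ j → j ≢ i → f j ≈ 0#) → sumF n f ≈ f i
  sumF-single (suc n) Fin.zero    f≈0 =
    trans (+-congˡ (sumF-zero n (λ j → f≈0 (Fin.suc j) λ ()))) (+-identityʳ _)
  sumF-single (suc n) (Fin.suc i) f≈0 =
    trans (+-cong (f≈0 Fin.zero λ ()) (sumF-single n i (λ j j≢i → f≈0 (Fin.suc j) (j≢i ∘ FinP.suc-injective))))
          (+-identityˡ _)

  sumF-splitAt : ∀ m n (f : Fin m ⊎ Fin n → Carrier) →
                 sumF (m ℕ.+ n) (f ∘ splitAt m) ≈ sumF m (f ∘ inj₁) + sumF n (f ∘ inj₂)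
  sumF-splitAt zero    n f = sym (+-identityˡ _)
  sumF-splitAt (suc m) n f =
    trans (+-congˡ (sumF-splitAt m n (f ∘ map₁ Fin.suc))) (sym (+-assoc _ _ _))

  identity-diag : ∀ {n} (i : Fin n) → identity i i ≈ 1#
  identity-diag i with i FinP.≟ i
  ... | yes _  = refl
  ... | no i≢i = ⊥-elim (i≢i ≡.refl)

  identity-off : ∀ {n} {i j : Fin n} → i ≢ j → identity i j ≈ 0#
  identity-off {i = i} {j} i≢j with i FinP.≟ j
  ... | yes i≡j = ⊥-elim (i≢j i≡j)
  ... | no _    = refl

  identity-sym : ∀ {n} (i j : Fin n) → identity i j ≈ identity j i
  identity-sym i j with i FinP.≟ j
  ... | yes ≡.refl = sym (identity-diag i)
  ... | no i≢j     = sym (identity-off (i≢j ∘ ≡.sym))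

  identity-reindex : ∀ {m n} {f : Fin m → Fin n} → (∀ {i j} → f i ≡ f j → i ≡ j) →
                     ∀ i j → identity (f i) (f j) ≈ identity i j
  identity-reindex {f = f} f-inj i j with i FinP.≟ j
  ... | yes ≡.refl = identity-diag (f i)
  ... | no i≢j     = identity-off (i≢j ∘ f-inj)

  *-identity-transfer : ∀ {n} (v : Vec n) i j → v i * identity i j ≈ v j * identity i j
  *-identity-transfer v i j with i FinP.≟ j
  ... | yes ≡.refl = refl
  ... | no _       = trans (zeroʳ _) (sym (zeroʳ _))

  sumF-identity : ∀ n (j : Fin n) → sumF n (λ l → identity l j) ≈ 1#
  sumF-identity n j = trans (sumF-single n j (λ l → identity-off)) (identity-diag j)

  ⊗-identityˡ : ∀ {m n} (A : Mat m n) → (identity ⊗ A) ≈ₘ A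
  ⊗-identityˡ {m} A i j = begin
    sumF m (λ l → identity i l * A l j)
      ≈⟨ sumF-single m i (λ l l≢i → trans (*-congʳ (identity-off (l≢i ∘ ≡.sym))) (zeroˡ _)) ⟩
    identity i i * A i j                ≈⟨ *-congʳ (identity-diag i) ⟩
    1# * A i j                          ≈⟨ *-identityˡ _ ⟩
    A i j                               ∎

  ⊗-identityʳ : ∀ {m n} (A : Mat m n) → (A ⊗ identity) ≈ₘ A
  ⊗-identityʳ {n = n} A i j = begin
    sumF n (λ l → A i l * identity l j)
      ≈⟨ sumF-single n j (λ l l≢j → trans (*-congˡ (identity-off l≢j)) (zeroʳ _)) ⟩
    A i j * identity j j                ≈⟨ *-congˡ (identity-diag j) ⟩
    A i j * 1#                          ≈⟨ *-identityʳ _ ⟩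
    A i j                               ∎

  ⊗-diagʳ : ∀ {m n} (A : Mat m n) (d : Vec n) i j → (A ⊗ diag d) i j ≈ A i j * d j
  ⊗-diagʳ {n = n} A d i j = begin
    sumF n (λ l → A i l * diag d l j)
      ≈⟨ sumF-single n j (λ l l≢j → trans (*-congˡ (diag-off l≢j)) (zeroʳ _)) ⟩
    A i j * diag d j j                ≈⟨ *-congˡ (diag-diag j) ⟩
    A i j * d j                       ∎
    where
    diag-off : ∀ {l} → l ≢ j → diag d l j ≈ 0#
    diag-off {l} l≢j with l FinP.≟ j
    ... | yes l≡j = ⊥-elim (l≢j l≡j)
    ... | no _    = refl
    diag-diag : ∀ l → diag d l l ≈ d l
    diag-diag l with l FinP.≟ l
    ... | yes _  = refl
    ... | no l≢l = ⊥-elim (l≢l ≡.refl)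

  infixl 6 _⊕_
  _⊕_ : ∀ {m n} → Mat m n → Mat m n → Mat m n
  (A ⊕ B) i j = A i j + B i j

  infix 30 -ₘ_
  -ₘ_ : ∀ {m n} → Mat m n → Mat m n
  (-ₘ A) i j = - A i j

  ⊗-negˡ : ∀ {m n p} (A : Mat m n) (B : Mat n p) → ((-ₘ A) ⊗ B) ≈ₘ (-ₘ (A ⊗ B))
  ⊗-negˡ {n = n} A B i j = trans (sumF-cong n (λ l → sym (-‿distribˡ-* _ _))) (sumF-neg n _)

  ⊗-negʳ : ∀ {m n p} (A : Mat m n) (B : Mat n p) → (A ⊗ (-ₘ B)) ≈ₘ (-ₘ (A ⊗ B))
  ⊗-negʳ {n = n} A B i j = trans (sumF-cong n (λ l → sym (-‿distribʳ-* _ _))) (sumF-neg n _)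

  ⊗-cong : ∀ {m n p} {A A′ : Mat m n} {B B′ : Mat n p} →
           A ≈ₘ A′ → B ≈ₘ B′ → (A ⊗ B) ≈ₘ (A′ ⊗ B′)
  ⊗-cong {n = n} A≈A′ B≈B′ i j = sumF-cong n (λ l → *-cong (A≈A′ i l) (B≈B′ l j))

  ⊗-assoc : ∀ {m n p q} (A : Mat m n) (B : Mat n p) (C : Mat p q) → ((A ⊗ B) ⊗ C) ≈ₘ (A ⊗ (B ⊗ C))
  ⊗-assoc {n = n} {p} A B C i j = begin
    sumF p (λ l → sumF n (λ t → A i t * B t l) * C l j)   ≈⟨ sumF-cong p (λ l → *-distribʳ-sumF n (C l j) _) ⟩
    sumF p (λ l → sumF n (λ t → A i t * B t l * C l j))   ≈⟨ sumF-comm p n _ ⟩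
    sumF n (λ t → sumF p (λ l → A i t * B t l * C l j))   ≈⟨ sumF-cong n (λ t → sumF-cong p (λ l → *-assoc _ _ _)) ⟩
    sumF n (λ t → sumF p (λ l → A i t * (B t l * C l j))) ≈⟨ sumF-cong n (λ t → *-distribˡ-sumF p (A i t) _) ⟨
    sumF n (λ t → A i t * sumF p (λ l → B t l * C l j))   ∎

  ⊗-distribʳ-⊕ : ∀ {m n p} (A B : Mat m n) (C : Mat n p) → ((A ⊕ B) ⊗ C) ≈ₘ ((A ⊗ C) ⊕ (B ⊗ C))
  ⊗-distribʳ-⊕ {n = n} A B C i j = trans (sumF-cong n (λ l → distribʳ _ _ _)) (sumF-+ n _ _)

  ⊗-distribˡ-⊕ : ∀ {m n p} (A : Mat m n) (B C : Mat n p) → (A ⊗ (B ⊕ C)) ≈ₘ ((A ⊗ B) ⊕ (A ⊗ C))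
  ⊗-distribˡ-⊕ {n = n} A B C i j = trans (sumF-cong n (λ l → distribˡ _ _ _)) (sumF-+ n _ _)

  unipotent-⊗ : ∀ {n} (M N : Mat n n) →
                ((identity ⊕ M) ⊗ (identity ⊕ N)) ≈ₘ (identity ⊕ M ⊕ N ⊕ (M ⊗ N))
  unipotent-⊗ M N i j = begin
    ((identity ⊕ M) ⊗ (identity ⊕ N)) i j
      ≈⟨ ⊗-distribʳ-⊕ identity M (identity ⊕ N) i j ⟩
    (identity ⊗ (identity ⊕ N)) i j + (M ⊗ (identity ⊕ N)) i j
      ≈⟨ +-cong (⊗-identityˡ (identity ⊕ N) i j) (⊗-distribˡ-⊕ M identity N i j) ⟩
    (identity i j + N i j) + ((M ⊗ identity) i j + (M ⊗ N) i j)
      ≈⟨ +-congˡ (+-congʳ (⊗-identityʳ M i j)) ⟩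
    (identity i j + N i j) + (M i j + (M ⊗ N) i j)
      ≈⟨ interchange _ _ _ _ ⟩
    (identity i j + M i j) + (N i j + (M ⊗ N) i j)
      ≈⟨ +-assoc _ _ _ ⟨
    identity i j + M i j + N i j + (M ⊗ N) i j
      ∎

  unipotent-inverse : ∀ {n} (N : Mat n n) → (∀ i j → (N ⊗ N) i j ≈ 0#) →
                      IsInverse (identity ⊕ N) (identity ⊖ N)
  unipotent-inverse N N²≈0 = right , left
    where
    -N² : ∀ i j → - (N ⊗ N) i j ≈ 0#
    -N² i j = trans (-‿cong (N²≈0 i j)) -0#≈0#
    right : ((identity ⊕ N) ⊗ (identity ⊖ N)) ≈ₘ identity
    right i j = begin
      ((identity ⊕ N) ⊗ (identity ⊕ -ₘ N)) i j        ≈⟨ unipotent-⊗ N (-ₘ N) i j ⟩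
      identity i j + N i j - N i j + (N ⊗ -ₘ N) i j  ≈⟨ +-cong (+-assoc _ _ _) (trans (⊗-negʳ N N i j) (-N² i j)) ⟩
      identity i j + (N i j - N i j) + 0#           ≈⟨ +-identityʳ _ ⟩
      identity i j + (N i j - N i j)                ≈⟨ +-congˡ (-‿inverseʳ _) ⟩
      identity i j + 0#                             ≈⟨ +-identityʳ _ ⟩
      identity i j                                  ∎
    left : ((identity ⊖ N) ⊗ (identity ⊕ N)) ≈ₘ identity
    left i j = begin
      ((identity ⊕ -ₘ N) ⊗ (identity ⊕ N)) i j        ≈⟨ unipotent-⊗ (-ₘ N) N i j ⟩
      identity i j - N i j + N i j + (-ₘ N ⊗ N) i j  ≈⟨ +-cong (+-assoc _ _ _) (trans (⊗-negˡ N N i j) (-N² i j)) ⟩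
      identity i j + (- N i j + N i j) + 0#         ≈⟨ +-identityʳ _ ⟩
      identity i j + (- N i j + N i j)              ≈⟨ +-congˡ (-‿inverseˡ _) ⟩
      identity i j + 0#                             ≈⟨ +-identityʳ _ ⟩
      identity i j                                  ∎

  IsInverse-⊗ : ∀ {n} {P P⁻¹ Q Q⁻¹ : Mat n n} → IsInverse P P⁻¹ → IsInverse Q Q⁻¹ →
                IsInverse (P ⊗ Q) (Q⁻¹ ⊗ P⁻¹)
  IsInverse-⊗ {P = P} {P⁻¹} {Q} {Q⁻¹} (PP⁻¹ , P⁻¹P) (QQ⁻¹ , Q⁻¹Q) =
    cancel P Q Q⁻¹ P⁻¹ QQ⁻¹ PP⁻¹ , cancel Q⁻¹ P⁻¹ P Q P⁻¹P Q⁻¹Q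
    where
    cancel : ∀ A B C D → (B ⊗ C) ≈ₘ identity → (A ⊗ D) ≈ₘ identity → ((A ⊗ B) ⊗ (C ⊗ D)) ≈ₘ identity
    cancel A B C D BC≈I AD≈I i j = begin
      ((A ⊗ B) ⊗ (C ⊗ D)) i j ≈⟨ ⊗-assoc A B (C ⊗ D) i j ⟩
      (A ⊗ (B ⊗ (C ⊗ D))) i j ≈⟨ ⊗-cong {A = A} (λ _ _ → refl) (λ a b → sym (⊗-assoc B C D a b)) i j ⟩
      (A ⊗ ((B ⊗ C) ⊗ D)) i j ≈⟨ ⊗-cong {A = A} (λ _ _ → refl) (⊗-cong {B = D} BC≈I (λ _ _ → refl)) i j ⟩
      (A ⊗ (identity ⊗ D)) i j ≈⟨ ⊗-cong {A = A} (λ _ _ → refl) (⊗-identityˡ D) i j ⟩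
      (A ⊗ D) i j              ≈⟨ AD≈I i j ⟩
      identity i j             ∎

  basis : ∀ {n} → Fin n → Vec n
  basis q p = identity p q

  ·-basis : ∀ {m n} (A : Mat m n) q → (A · basis q) ≈ᵥ (λ p → A p q)
  ·-basis A q p = ⊗-identityʳ A p q

  ·-congʳ : ∀ {m n} (A : Mat m n) {x y : Vec n} → x ≈ᵥ y → (A · x) ≈ᵥ (A · y)
  ·-congʳ {n = n} A x≈y i = sumF-cong n (λ l → *-congˡ (x≈y l))

  ·-neg : ∀ {m n} (A : Mat m n) (x : Vec n) → (A · (λ l → - x l)) ≈ᵥ (λ i → - (A · x) i)
  ·-neg {n = n} A x i = trans (sumF-cong n (λ l → sym (-‿distribʳ-* _ _))) (sumF-neg n _)

  ·-zeroʳ : ∀ {m n} (A : Mat m n) → (A · (λ _ → 0#)) ≈ᵥ (λ _ → 0#)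
  ·-zeroʳ {n = n} A i = sumF-zero n (λ l → zeroʳ _)

  ·-zero-row : ∀ {m n} (A : Mat m n) (x : Vec n) i → (∀ l → A i l ≈ 0#) → (A · x) i ≈ 0#
  ·-zero-row {n = n} A x i row≈0 = sumF-zero n (λ l → trans (*-congʳ (row≈0 l)) (zeroˡ _))

  ⊗-· : ∀ {m n p} (A : Mat m n) (B : Mat n p) (x : Vec p) → ((A ⊗ B) · x) ≈ᵥ (A · (B · x))
  ⊗-· A B x i = ⊗-assoc A B (λ l (_ : Fin 1) → x l) i Fin.zero

  ⟦,⟧-· : ∀ {n} (A B : Mat n n) (x : Vec n) → (⟦ A , B ⟧ · x) ≈ᵥ (λ i → (A · (B · x)) i - (B · (A · x)) i)
  ⟦,⟧-· {n} A B x i = begin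
    sumF n (λ l → ((A ⊗ B) i l - (B ⊗ A) i l) * x l)
      ≈⟨ sumF-cong n (λ l → trans (distribʳ _ _ _) (+-congˡ (sym (-‿distribˡ-* _ _)))) ⟩
    sumF n (λ l → (A ⊗ B) i l * x l + - ((B ⊗ A) i l * x l))
      ≈⟨ trans (sumF-+ n _ _) (+-congˡ (sumF-neg n _)) ⟩
    ((A ⊗ B) · x) i - ((B ⊗ A) · x) i
      ≈⟨ +-cong (⊗-· A B x i) (-‿cong (⊗-· B A x i)) ⟩
    (A · (B · x)) i - (B · (A · x)) i
      ∎

  ⟦,⟧-·-antisym : ∀ {n} (A B : Mat n n) (x : Vec n) → (⟦ A , B ⟧ · x) ≈ᵥ (λ i → - (⟦ B , A ⟧ · x) i)
  ⟦,⟧-·-antisym A B x i = begin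
    (⟦ A , B ⟧ · x) i             ≈⟨ ⟦,⟧-· A B x i ⟩
    ab - ba                       ≈⟨ +-congʳ (-‿involutive ab) ⟨
    - - ab - ba                   ≈⟨ -‿anti-homo-+ ba (- ab) ⟨
    - (ba - ab)                   ≈⟨ -‿cong (⟦,⟧-· B A x i) ⟨
    - (⟦ B , A ⟧ · x) i           ∎
    where
    ab = (A · (B · x)) i
    ba = (B · (A · x)) i

  HasDim-coordinates : ∀ {a d n} {W : Vec n → Set a} (ι : Fin d → Fin n) → (∀ {s t} → ι s ≡ ι t → s ≡ t) →
                       (∀ t → W (basis (ι t))) → (∀ w → W w → ∀ p → (∀ t → ι t ≢ p) → w p ≈ 0#) →
                       HasDim W d
  HasDim-coordinates {d = d} {n} {W} ι ι-inj basis∈W W-support =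
    basis ∘ ι , basis∈W , independent , spanning
    where
    lincomb-at-ι : ∀ coef t → lincomb (basis ∘ ι) coef (ι t) ≈ coef t
    lincomb-at-ι coef t = begin
      sumF d (λ s → coef s * identity (ι t) (ι s))
        ≈⟨ sumF-single d t (λ s s≢t → trans (*-congˡ (identity-off (s≢t ∘ ≡.sym ∘ ι-inj))) (zeroʳ _)) ⟩
      coef t * identity (ι t) (ι t)                ≈⟨ *-congˡ (identity-diag (ι t)) ⟩
      coef t * 1#                                  ≈⟨ *-identityʳ _ ⟩
      coef t                                       ∎

    independent : LinIndep (basis ∘ ι)
    independent coef lincomb≈0 t = trans (sym (lincomb-at-ι coef t)) (lincomb≈0 (ι t))

    spanning : ∀ w → W w → ∃ λ coef → w ≈ᵥ lincomb (basis ∘ ι) coef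
    spanning w w∈W = w ∘ ι , at
      where
      at : ∀ p → w p ≈ lincomb (basis ∘ ι) (w ∘ ι) p
      at p with FinP.any? (λ t → ι t FinP.≟ p)
      ... | yes (t , ≡.refl) = sym (lincomb-at-ι (w ∘ ι) t)
      ... | no p∉ι = trans (W-support w w∈W p (λ t ιt≡p → p∉ι (t , ιt≡p))) (sym (sumF-zero d off-ι))
        where
        off-ι : ∀ s → w (ι s) * identity p (ι s) ≈ 0#
        off-ι s = trans (*-congˡ (identity-off λ p≡ιs → p∉ι (s , ≡.sym p≡ιs))) (zeroʳ _)

module Construction {c ℓ} (K : CommutativeRing c ℓ) {n k g : ℕ} (n≤n+k : n ≤ n ℕ.+ k)
  (slot : Fin g → Fin k → Fin n) (slot-injective : ∀ {a b J J′} → slot a J ≡ slot b J′ → a ≡ b × J ≡ J′)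
  where
  open CommutativeRing K
  open LinAlg K
  open MatrixAlgebra K
  open RingProperties ring using (-0#≈0#; -‿involutive; -‿distribʳ-*; [y-z]x≈yx-zx; x[y-z]≈xy-xz)
  open SetoidReasoning setoid

  X : Mat n k
  X p J = sumF g (λ c → identity (slot c J) p)

  Xᵀ : Mat k n
  Xᵀ J p = X p J

  χ : Fin g → Vec n
  χ a p = sumF k (λ J → identity (slot a J) p)

  -- Matrices on Fin (n + k) are given in block form through splitAt: U = [[0, X], [0, 0]], L = [[0, 0], [Xᵀ, 0]].
  upperRight : Fin n ⊎ Fin k → Fin n ⊎ Fin k → Carrier
  upperRight (inj₁ p) (inj₂ J) = X p J
  upperRight _        _        = 0#

  lowerLeft : Fin n ⊎ Fin k → Fin n ⊎ Fin k → Carrier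
  lowerLeft (inj₂ J) (inj₁ p) = X p J
  lowerLeft _        _        = 0#

  U : Mat (n ℕ.+ k) (n ℕ.+ k)
  U i j = upperRight (splitAt n i) (splitAt n j)

  L : Mat (n ℕ.+ k) (n ℕ.+ k)
  L i j = lowerLeft (splitAt n i) (splitAt n j)

  R : Mat (n ℕ.+ k) (n ℕ.+ k)
  R = (identity ⊕ U) ⊗ (identity ⊖ L)

  R⁻¹ : Mat (n ℕ.+ k) (n ℕ.+ k)
  R⁻¹ = (identity ⊕ L) ⊗ (identity ⊖ U)

  d : Fin g → Vec (n ℕ.+ k)
  d a = χ a ++ (λ _ → 0#)

  Z : Fin g → Mat (n ℕ.+ k) (n ℕ.+ k)
  Z a = (R⁻¹ ⊗ diag (d a)) ⊗ R

  A : Fin g → Mat n n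
  A a = topLeft n≤n+k (Z a)

  R-inverse : IsInverse R R⁻¹
  R-inverse = IsInverse-⊗ (unipotent-inverse U U²≈0) (swap (unipotent-inverse L L²≈0))
    where
    U²≈0 : ∀ i j → (U ⊗ U) i j ≈ 0#
    U²≈0 i j = sumF-zero (n ℕ.+ k) (λ l → nil (splitAt n i) (splitAt n l) (splitAt n j))
      where
      nil : ∀ s t u → upperRight s t * upperRight t u ≈ 0#
      nil (inj₁ _) (inj₂ _) _ = zeroʳ _
      nil (inj₁ _) (inj₁ _) _ = zeroˡ _
      nil (inj₂ _) _        _ = zeroˡ _
    L²≈0 : ∀ i j → (L ⊗ L) i j ≈ 0#
    L²≈0 i j = sumF-zero (n ℕ.+ k) (λ l → nil (splitAt n i) (splitAt n l) (splitAt n j))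
      where
      nil : ∀ s t u → lowerLeft s t * lowerLeft t u ≈ 0#
      nil (inj₂ _) (inj₁ _) _ = zeroʳ _
      nil (inj₂ _) (inj₂ _) _ = zeroˡ _
      nil (inj₁ _) _        _ = zeroˡ _

  top : Fin n → Fin (n ℕ.+ k)
  top p = Fin.inject≤ p n≤n+k

  top-injective : ∀ {p q} → top p ≡ top q → p ≡ q
  top-injective = FinP.inject≤-injective n≤n+k n≤n+k _ _

  splitAt-top : ∀ p → splitAt n (top p) ≡ inj₁ p
  splitAt-top p = ≡.trans (≡.cong (splitAt n) top≡↑ˡ) (FinP.splitAt-↑ˡ n p k)
    where
    top≡↑ˡ : top p ≡ p Fin.↑ˡ k
    top≡↑ˡ = FinP.toℕ-injective (≡.trans (FinP.toℕ-inject≤ p n≤n+k) (≡.sym (FinP.toℕ-↑ˡ p k)))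

  U-top-row : ∀ p j → U (top p) j ≡ upperRight (inj₁ p) (splitAt n j)
  U-top-row p j = ≡.cong (λ s → upperRight s (splitAt n j)) (splitAt-top p)

  L-top-row : ∀ p j → L (top p) j ≈ 0#
  L-top-row p j = reflexive (≡.cong (λ s → lowerLeft s (splitAt n j)) (splitAt-top p))

  UL-top-block : ∀ p q → (U ⊗ L) (top p) (top q) ≈ (X ⊗ Xᵀ) p q
  UL-top-block p q = begin
    sumF (n ℕ.+ k) (λ l → U (top p) l * L l (top q))
      ≡⟨ ≡.cong₂ (λ s t → sumF (n ℕ.+ k) (λ l → upperRight s (splitAt n l) * lowerLeft (splitAt n l) t))
                 (splitAt-top p) (splitAt-top q) ⟩
    sumF (n ℕ.+ k) (f ∘ splitAt n)                     ≈⟨ sumF-splitAt n k f ⟩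
    sumF n (λ _ → 0# * 0#) + (X ⊗ Xᵀ) p q             ≈⟨ +-congʳ (sumF-zero n (λ _ → zeroˡ 0#)) ⟩
    0# + (X ⊗ Xᵀ) p q                                 ≈⟨ +-identityˡ _ ⟩
    (X ⊗ Xᵀ) p q                                      ∎
    where
    f : Fin n ⊎ Fin k → Carrier
    f t = upperRight (inj₁ p) t * lowerLeft t (inj₁ q)

  R-top-block : ∀ p q → R (top p) (top q) ≈ identity (top p) (top q) - (X ⊗ Xᵀ) p q
  R-top-block p q = begin
    R (top p) (top q)
      ≈⟨ unipotent-⊗ U (-ₘ L) (top p) (top q) ⟩
    identity (top p) (top q) + U (top p) (top q) + - L (top p) (top q) + (U ⊗ -ₘ L) (top p) (top q)
      ≈⟨ +-cong (+-cong (+-congˡ (reflexive U-top-top)) (-‿cong (L-top-row p (top q)))) (⊗-negʳ U L (top p) (top q)) ⟩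
    identity (top p) (top q) + 0# + - 0# - (U ⊗ L) (top p) (top q)
      ≈⟨ +-cong (trans (+-congˡ -0#≈0#) (trans (+-identityʳ _) (+-identityʳ _))) (-‿cong (UL-top-block p q)) ⟩
    identity (top p) (top q) - (X ⊗ Xᵀ) p q
      ∎
    where
    U-top-top : U (top p) (top q) ≡ 0#
    U-top-top = ≡.trans (U-top-row p (top q)) (≡.cong (upperRight (inj₁ p)) (splitAt-top q))

  R⁻¹-top-row : ∀ p m → R⁻¹ (top p) m ≈ identity (top p) m - U (top p) m
  R⁻¹-top-row p m = begin
    R⁻¹ (top p) m
      ≈⟨ unipotent-⊗ L (-ₘ U) (top p) m ⟩
    identity (top p) m + L (top p) m - U (top p) m + (L ⊗ -ₘ U) (top p) m
      ≈⟨ +-cong (+-congʳ (+-congˡ (L-top-row p m))) (·-zero-row L _ (top p) (L-top-row p)) ⟩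
    identity (top p) m + 0# - U (top p) m + 0#
      ≈⟨ trans (+-identityʳ _) (+-congʳ (+-identityʳ _)) ⟩
    identity (top p) m - U (top p) m
      ∎

  Z-top-row : ∀ a p j → Z a (top p) j ≈ χ a p * R (top p) j
  Z-top-row a p j = begin
    sumF (n ℕ.+ k) (λ m → (R⁻¹ ⊗ diag (d a)) (top p) m * R m j)
      ≈⟨ sumF-cong (n ℕ.+ k) (λ m → trans (*-congʳ (R⁻¹D-top-row m)) (*-assoc _ _ _)) ⟩
    sumF (n ℕ.+ k) (λ m → identity (top p) m * (d a m * R m j))
      ≈⟨ ⊗-identityˡ (λ m j → d a m * R m j) (top p) j ⟩
    d a (top p) * R (top p) j
      ≡⟨ ≡.cong (λ s → [ χ a , (λ _ → 0#) ] s * R (top p) j) (splitAt-top p) ⟩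
    χ a p * R (top p) j
      ∎
    where
    U*d≈0 : ∀ t → upperRight (inj₁ p) t * [ χ a , (λ _ → 0#) ] t ≈ 0#
    U*d≈0 (inj₁ _) = zeroˡ _
    U*d≈0 (inj₂ _) = zeroʳ _
    R⁻¹D-top-row : ∀ m → (R⁻¹ ⊗ diag (d a)) (top p) m ≈ identity (top p) m * d a m
    R⁻¹D-top-row m = begin
      (R⁻¹ ⊗ diag (d a)) (top p) m                       ≈⟨ ⊗-diagʳ R⁻¹ (d a) (top p) m ⟩
      R⁻¹ (top p) m * d a m                              ≈⟨ *-congʳ (R⁻¹-top-row p m) ⟩
      (identity (top p) m - U (top p) m) * d a m         ≈⟨ [y-z]x≈yx-zx _ _ _ ⟩
      identity (top p) m * d a m - U (top p) m * d a m   ≈⟨ +-congˡ (-‿cong U*d≈0′) ⟩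
      identity (top p) m * d a m - 0#                    ≈⟨ trans (+-congˡ -0#≈0#) (+-identityʳ _) ⟩
      identity (top p) m * d a m                         ∎
      where
      U*d≈0′ : U (top p) m * d a m ≈ 0#
      U*d≈0′ = trans (reflexive (≡.cong (_* d a m) (U-top-row p m))) (U*d≈0 (splitAt n m))

  A-entry : ∀ a p q → A a p q ≈ χ a p * (identity p q - (X ⊗ Xᵀ) p q)
  A-entry a p q = begin
    A a p q                                                ≈⟨ Z-top-row a p (top q) ⟩
    χ a p * R (top p) (top q)                              ≈⟨ *-congˡ (R-top-block p q) ⟩
    χ a p * (identity (top p) (top q) - (X ⊗ Xᵀ) p q)      ≈⟨ *-congˡ (+-congʳ (identity-reindex top-injective p q)) ⟩
    χ a p * (identity p q - (X ⊗ Xᵀ) p q)                  ∎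

  identity-slot : ∀ a b J J′ → identity (slot a J) (slot b J′) ≈ identity a b * identity J J′
  identity-slot a b J J′ with a FinP.≟ b | J FinP.≟ J′
  ... | yes ≡.refl | yes ≡.refl = trans (identity-diag (slot a J)) (sym (*-identityˡ 1#))
  ... | no a≢b     | _          = trans (identity-off (a≢b ∘ proj₁ ∘ slot-injective)) (sym (zeroˡ _))
  ... | yes _      | no J≢J′    = trans (identity-off (J≢J′ ∘ proj₂ ∘ slot-injective)) (sym (zeroʳ _))

  X-slot : ∀ i J J′ → X (slot i J) J′ ≈ identity J′ J
  X-slot i J J′ = begin
    sumF g (λ c → identity (slot c J′) (slot i J))  ≈⟨ sumF-cong g (λ c → identity-slot c i J′ J) ⟩
    sumF g (λ c → identity c i * identity J′ J)     ≈⟨ *-distribʳ-sumF g _ _ ⟨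
    sumF g (λ c → identity c i) * identity J′ J     ≈⟨ *-congʳ (sumF-identity g i) ⟩
    1# * identity J′ J                              ≈⟨ *-identityˡ _ ⟩
    identity J′ J                                   ∎

  χ-slot : ∀ a c J → χ a (slot c J) ≈ identity a c
  χ-slot a c J = begin
    sumF k (λ J′ → identity (slot a J′) (slot c J))  ≈⟨ sumF-cong k (λ J′ → identity-slot a c J′ J) ⟩
    sumF k (λ J′ → identity a c * identity J′ J)     ≈⟨ *-distribˡ-sumF k _ _ ⟨
    identity a c * sumF k (λ J′ → identity J′ J)     ≈⟨ *-congˡ (sumF-identity k J) ⟩
    identity a c * 1#                                ≈⟨ *-identityʳ _ ⟩
    identity a c                                     ∎

  χ-outside : ∀ a p → (∀ J → slot a J ≢ p) → χ a p ≈ 0#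
  χ-outside a p p∉slot = sumF-zero k (λ J → identity-off (p∉slot J))

  χ*X : ∀ a p J → χ a p * X p J ≈ identity p (slot a J)
  χ*X a p J = begin
    χ a p * sumF g (λ c → identity (slot c J) p)               ≈⟨ *-distribˡ-sumF g _ _ ⟩
    sumF g (λ c → χ a p * identity (slot c J) p)
      ≈⟨ sumF-cong g (λ c → *-identity-transfer (χ a) (slot c J) p) ⟨
    sumF g (λ c → χ a (slot c J) * identity (slot c J) p)      ≈⟨ sumF-cong g (λ c → *-congʳ (χ-slot a c J)) ⟩
    sumF g (λ c → identity a c * identity (slot c J) p)        ≈⟨ ⊗-identityˡ (λ c q → identity (slot c J) q) a p ⟩
    identity (slot a J) p                                      ≈⟨ identity-sym (slot a J) p ⟩
    identity p (slot a J)                                      ∎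

  A-slot : ∀ a i J p → A a p (slot i J) ≈ identity a i * identity p (slot i J) - identity p (slot a J)
  A-slot a i J p = begin
    A a p (slot i J)                                                   ≈⟨ A-entry a p (slot i J) ⟩
    χ a p * (identity p (slot i J) - (X ⊗ Xᵀ) p (slot i J))            ≈⟨ *-congˡ (+-congˡ (-‿cong XXᵀ-slot)) ⟩
    χ a p * (identity p (slot i J) - X p J)                            ≈⟨ x[y-z]≈xy-xz _ _ _ ⟩
    χ a p * identity p (slot i J) - χ a p * X p J
      ≈⟨ +-cong (*-identity-transfer (χ a) p (slot i J)) (-‿cong (χ*X a p J)) ⟩
    χ a (slot i J) * identity p (slot i J) - identity p (slot a J)     ≈⟨ +-congʳ (*-congʳ (χ-slot a i J)) ⟩
    identity a i * identity p (slot i J) - identity p (slot a J)       ∎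
    where
    XXᵀ-slot : (X ⊗ Xᵀ) p (slot i J) ≈ X p J
    XXᵀ-slot = trans (sumF-cong k (λ J′ → *-congˡ (X-slot i J J′))) (⊗-identityʳ X p J)

  A-basis-same : ∀ a J → (A a · basis (slot a J)) ≈ᵥ (λ _ → 0#)
  A-basis-same a J p = begin
    (A a · basis (slot a J)) p                                    ≈⟨ ·-basis (A a) (slot a J) p ⟩
    A a p (slot a J)                                              ≈⟨ A-slot a a J p ⟩
    identity a a * identity p (slot a J) - identity p (slot a J)
      ≈⟨ +-congʳ (trans (*-congʳ (identity-diag a)) (*-identityˡ _)) ⟩
    identity p (slot a J) - identity p (slot a J)                 ≈⟨ -‿inverseʳ _ ⟩
    0#                                                            ∎

  A-basis-other : ∀ {a i} J → a ≢ i → (A a · basis (slot i J)) ≈ᵥ (λ p → - basis (slot a J) p)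
  A-basis-other {a} {i} J a≢i p = begin
    (A a · basis (slot i J)) p                                    ≈⟨ ·-basis (A a) (slot i J) p ⟩
    A a p (slot i J)                                              ≈⟨ A-slot a i J p ⟩
    identity a i * identity p (slot i J) - identity p (slot a J)
      ≈⟨ +-congʳ (trans (*-congʳ (identity-off a≢i)) (zeroˡ _)) ⟩
    0# - identity p (slot a J)                                    ≈⟨ +-identityˡ _ ⟩
    - identity p (slot a J)                                       ∎

  A-outside : ∀ a p q → (∀ c J → slot c J ≢ p) → A a p q ≈ 0#
  A-outside a p q p∉slots = trans (A-entry a p q) (trans (*-congʳ (χ-outside a p (p∉slots a))) (zeroˡ _))

  ⟦A,A⟧-basis : ∀ {a b} J → a ≢ b → (⟦ A a , A b ⟧ · basis (slot a J)) ≈ᵥ basis (slot a J)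
  ⟦A,A⟧-basis {a} {b} J a≢b p = begin
    (⟦ A a , A b ⟧ · eᵃ) p
      ≈⟨ ⟦,⟧-· (A a) (A b) eᵃ p ⟩
    (A a · (A b · eᵃ)) p - (A b · (A a · eᵃ)) p
      ≈⟨ +-cong (·-congʳ (A a) (A-basis-other J (a≢b ∘ ≡.sym)) p) (-‿cong (·-congʳ (A b) (A-basis-same a J) p)) ⟩
    (A a · (λ q → - eᵇ q)) p - (A b · (λ _ → 0#)) p
      ≈⟨ +-cong (·-neg (A a) eᵇ p) (-‿cong (·-zeroʳ (A b) p)) ⟩
    - (A a · eᵇ) p - 0#
      ≈⟨ +-cong (-‿cong (A-basis-other J a≢b p)) -0#≈0# ⟩
    - - eᵃ p + 0#
      ≈⟨ trans (+-identityʳ _) (-‿involutive _) ⟩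
    eᵃ p
      ∎
    where
    eᵃ = basis (slot a J)
    eᵇ = basis (slot b J)

  ⟦A,A⟧-neg-basis : ∀ {a b} J → a ≢ b → (⟦ A a , A b ⟧ · (λ q → - basis (slot b J) q)) ≈ᵥ basis (slot b J)
  ⟦A,A⟧-neg-basis {a} {b} J a≢b p = begin
    (⟦ A a , A b ⟧ · (λ q → - eᵇ q)) p   ≈⟨ ·-neg ⟦ A a , A b ⟧ eᵇ p ⟩
    - (⟦ A a , A b ⟧ · eᵇ) p             ≈⟨ -‿cong (⟦,⟧-·-antisym (A a) (A b) eᵇ p) ⟩
    - - (⟦ A b , A a ⟧ · eᵇ) p           ≈⟨ -‿involutive _ ⟩
    (⟦ A b , A a ⟧ · eᵇ) p               ≈⟨ ⟦A,A⟧-basis J (a≢b ∘ ≡.sym) p ⟩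
    eᵇ p                                 ∎
    where
    eᵇ = basis (slot b J)

  ⟦A,A⟧-outside : ∀ a b (x : Vec n) p → (∀ c J → slot c J ≢ p) → (⟦ A a , A b ⟧ · x) p ≈ 0#
  ⟦A,A⟧-outside a b x p p∉slots = begin
    (⟦ A a , A b ⟧ · x) p                        ≈⟨ ⟦,⟧-· (A a) (A b) x p ⟩
    (A a · (A b · x)) p - (A b · (A a · x)) p    ≈⟨ +-cong (row≈0 a (A b · x)) (-‿cong (row≈0 b (A a · x))) ⟩
    0# - 0#                                      ≈⟨ -‿inverseʳ 0# ⟩
    0#                                           ∎
    where
    row≈0 : ∀ c y → (A c · y) p ≈ 0#
    row≈0 c y = ·-zero-row (A c) y p (λ q → A-outside c p q p∉slots)

open import Data.Nat.Base using (_*_; _∸_)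

module ThreeBlocks {c ℓ} (K : CommutativeRing c ℓ) {n k : ℕ} (n≤n+k : n ≤ n ℕ.+ k) (3k≤n : 3 * k ≤ n) where
  open CommutativeRing K using (Carrier; _≈_; _+_; -_; 0#; setoid; sym; trans; +-cong; +-identityˡ; +-identityʳ)
  open LinAlg K
  open MatrixAlgebra K

  embed : Fin (3 * k) → Fin n
  embed t = Fin.inject≤ t 3k≤n

  embed-injective : ∀ {s t} → embed s ≡ embed t → s ≡ t
  embed-injective = FinP.inject≤-injective 3k≤n 3k≤n _ _

  slot : Fin 3 → Fin k → Fin n
  slot a J = embed (Fin.combine a J)

  slot-injective : ∀ {a b J J′} → slot a J ≡ slot b J′ → a ≡ b × J ≡ J′
  slot-injective = FinP.combine-injective _ _ _ _ ∘ embed-injective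

  open Construction K n≤n+k slot slot-injective public

  M₁ M₂ : Mat n n
  M₁ = ⟦ A 0F , A 1F ⟧
  M₂ = ⟦ A 0F , A 2F ⟧

  slot∈image : ∀ a J → ImSum M₁ M₂ (basis (slot a J))
  slot∈image 0F J = basis (slot 0F J) , (λ _ → 0#) , λ p →
    sym (trans (+-cong (⟦A,A⟧-basis {0F} {1F} J (λ ()) p) (·-zeroʳ M₂ p)) (+-identityʳ _))
  slot∈image 1F J = (λ q → - basis (slot 1F J) q) , (λ _ → 0#) , λ p →
    sym (trans (+-cong (⟦A,A⟧-neg-basis {0F} {1F} J (λ ()) p) (·-zeroʳ M₂ p)) (+-identityʳ _))
  slot∈image 2F J = (λ _ → 0#) , (λ q → - basis (slot 2F J) q) , λ p →
    sym (trans (+-cong (·-zeroʳ M₁ p) (⟦A,A⟧-neg-basis {0F} {2F} J (λ ()) p)) (+-identityˡ _))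

  image-dimension : HasDim (ImSum M₁ M₂) (3 * k)
  image-dimension = HasDim-coordinates embed embed-injective basis∈image image-support
    where
    basis∈image : ∀ t → ImSum M₁ M₂ (basis (embed t))
    basis∈image t =
      ≡.subst (ImSum M₁ M₂ ∘ basis ∘ embed) (FinP.combine-remQuot {3} k t) (uncurry slot∈image (Fin.remQuot k t))
    image-support : ∀ w → ImSum M₁ M₂ w → ∀ p → (∀ t → embed t ≢ p) → w p ≈ 0#
    image-support w (x , y , w≈) p p∉image = begin
      w p                    ≈⟨ w≈ p ⟩
      (M₁ · x) p + (M₂ · y) p ≈⟨ +-cong (⟦A,A⟧-outside 0F 1F x p p∉slots) (⟦A,A⟧-outside 0F 2F y p p∉slots) ⟩
      0# + 0#                ≈⟨ +-identityʳ 0# ⟩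
      0#                     ∎
      where
      open SetoidReasoning setoid
      p∉slots : ∀ c J → slot c J ≢ p
      p∉slots c J = p∉image (Fin.combine c J)

three-blocks-fit : ∀ n k → 3 * (n ℕ.+ k) ≤ 4 * n → 3 * k ≤ n
three-blocks-fit n k 3[n+k]≤4n = ℕP.+-cancelˡ-≤ (3 * n) (3 * k) n
  (≡.subst₂ _≤_ (ℕP.*-distribˡ-+ 3 n k) (ℕP.+-comm n (3 * n)) 3[n+k]≤4n)

theorem8 : ∀ {c ℓ} (K : CommutativeRing c ℓ) → LinAlg.IsField K → LinAlg.Infinite K →
  (n r : ℕ) (n≤r : n ≤ r) → 3 * r ≤ 4 * n →
  let open LinAlg K in
  ∃ λ (R : Mat r r) → ∃ λ (Rinv : Mat r r) → ∃ λ (d₁ : Vec r) → ∃ λ (d₂ : Vec r) → ∃ λ (d₃ : Vec r) →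
    IsInverse R Rinv ×
    (let A₁ = topLeft n≤r ((Rinv ⊗ diag d₁) ⊗ R)
         A₂ = topLeft n≤r ((Rinv ⊗ diag d₂) ⊗ R)
         A₃ = topLeft n≤r ((Rinv ⊗ diag d₃) ⊗ R)
     in HasDim (ImSum ⟦ A₁ , A₂ ⟧ ⟦ A₁ , A₃ ⟧) (3 * (r ∸ n)))
theorem8 K _ _ n r n≤r 3r≤4n with r ∸ n | ℕP.m+[n∸m]≡n n≤r
... | k | ≡.refl = R , R⁻¹ , d 0F , d 1F , d 2F , R-inverse , image-dimension
  where open ThreeBlocks K n≤r (three-blocks-fit n k 3r≤4n)
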